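{- Let $\mathcal{D}$ be any $i$-uniform distribution on subsets of $\{0,1\}^n$. For any fixed set $S\subseteq\{0,1\}^n$ with $|S|\ge2$, if $R\sim\mathcal{D}$ and $X=|S\cap R|$, then $\mathrm{Var}(X)\le\mathbb{E}X+(\mathrm{Boost}(\mathcal{D},|S|)-1)(\mathbb{E}X)^2$.
   Context: A distribution $\mathcal{D}$ on subsets of $\{0,1\}^n$ is $i$-uniform if, for $R\sim\mathcal{D}$, $\Pr[\sigma\in R]=2^{ -i}$ for every $\sigma\in\{0,1\}^n$. For $M\ge 2$, $$\mathrm{Boost}(\mathcal{D},M)=\max_{S'\subseteq\{0,1\}^n,\ |S'|\ge M}\ \frac{1}{|S'|(|S'|-1)}\sum_{\sigma,\tau\in S',\ \sigma\ne\tau}\frac{\Pr[\sigma,\tau\in R]}{\Pr[\sigma\in R]\Pr[\tau\in R]},$$ where $R\sim\mathcal{D}$.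
   Formalization: The distribution $\mathcal{D}$ assigns rational probabilities to the subsets of $\{0,1\}^n$ rather than real ones. -}

module Defs where

open import Data.Bool using (Bool; true; false; _∧_; if_then_else_)
open import Data.Nat using (ℕ; zero; suc; _∸_)
import Data.Nat as ℕ
open import Data.Integer using (+_)
open import Data.Rational using (ℚ; 0ℚ; 1ℚ; _+_; _*_; _-_; _÷_; _⊔_; _≤_; _/_; _≟_; ≢-nonZero)
open import Data.List using (List; []; _∷_; map; _++_; length; foldr)
open import Data.List.Relation.Unary.All using (All)
open import Data.Product using (_×_; _,_; proj₁; proj₂)
open import Data.Vec using (Vec; []; _∷_)
import Data.Vec.Properties as VecP
import Data.Bool.Properties as BoolP
open import Relation.Nullary using (yes; no)
open import Relation.Binary.PropositionalEquality using (_≡_)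

Point : ℕ → Set
Point n = Vec Bool n

allPoints : (n : ℕ) → List (Point n)
allPoints zero = [] ∷ []
allPoints (suc n) = map (true ∷_) (allPoints n) ++ map (false ∷_) (allPoints n)

Subset : ℕ → Set
Subset n = Point n → Bool

count : ∀ {n} → Subset n → ℕ
count {n} A = foldr (λ σ k → if A σ then suc k else k) 0 (allPoints n)

countInter : ∀ {n} → Subset n → Subset n → ℕ
countInter A B = count (λ σ → A σ ∧ B σ)

-- All sublists of a list (for a duplicate-free list: all its subsets)
sublists : ∀ {A : Set} → List A → List (List A)
sublists [] = [] ∷ []
sublists (x ∷ xs) = map (x ∷_) (sublists xs) ++ sublists xs

ℕtoℚ : ℕ → ℚ
ℕtoℚ k = (+ k) / 1

sumℚ : List ℚ → ℚ
sumℚ = foldr _+_ 0ℚ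

-- Division p / q, set to 0 when q = 0 (never used with q = 0 below for
-- uniform distributions)
ratio : ℚ → ℚ → ℚ
ratio p q with q ≟ 0ℚ
... | yes _ = 0ℚ
... | no q≢0 = _÷_ p q {{≢-nonZero q≢0}}

-- A finitely supported distribution on subsets of {0,1}^n: a list of
-- (subset, probability) pairs (repetitions allowed; weights add up).
Dist : ℕ → Set
Dist n = List (Subset n × ℚ)

IsDist : ∀ {n} → Dist n → Set
IsDist D = All (λ p → 0ℚ ≤ proj₂ p) D × sumℚ (map proj₂ D) ≡ 1ℚ

expect : ∀ {n} → Dist n → (Subset n → ℚ) → ℚ
expect D f = sumℚ (map (λ p → proj₂ p * f (proj₁ p)) D)

prob : ∀ {n} → Dist n → (Subset n → Bool) → ℚ
prob D E = expect D (λ R → if E R then 1ℚ else 0ℚ)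

Pr1 : ∀ {n} → Dist n → Point n → ℚ
Pr1 D σ = prob D (λ R → R σ)

Pr2 : ∀ {n} → Dist n → Point n → Point n → ℚ
Pr2 D σ τ = prob D (λ R → R σ ∧ R τ)

pow2inv : ℕ → ℚ
pow2inv zero = 1ℚ
pow2inv (suc i) = ((+ 1) / 2) * pow2inv i

IsUniform : ∀ {n} → ℕ → Dist n → Set
IsUniform {n} i D = (σ : Point n) → Pr1 D σ ≡ pow2inv i

pairSum : ∀ {n} → Dist n → List (Point n) → ℚ
pairSum {n} D S' = sumℚ (map (λ σ → sumℚ (map (λ τ → term σ τ) S')) S')
  where
  term : Point n → Point n → ℚ
  term σ τ with VecP.≡-dec BoolP._≟_ σ τ
  ... | yes _ = 0ℚ
  ... | no _ = ratio (Pr2 D σ τ) (Pr1 D σ * Pr1 D τ)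

avgPair : ∀ {n} → Dist n → List (Point n) → ℚ
avgPair D S' = ratio (pairSum D S') (ℕtoℚ (length S' ℕ.* (length S' ∸ 1)))

maxℚ : List ℚ → ℚ
maxℚ [] = 0ℚ
maxℚ (x ∷ xs) = foldr _⊔_ x xs

filterLen : ∀ {A : Set} → ℕ → List (List A) → List (List A)
filterLen M [] = []
filterLen M (xs ∷ xss) with M ℕ.≤? length xs
... | yes _ = xs ∷ filterLen M xss
... | no _ = filterLen M xss

Boost : ∀ {n} → Dist n → ℕ → ℚ
Boost {n} D M = maxℚ (map (avgPair D) (filterLen M (sublists (allPoints n))))

X : ∀ {n} → Subset n → Subset n → ℚ
X S R = ℕtoℚ (countInter S R)

EX : ∀ {n} → Dist n → Subset n → ℚ
EX D S = expect D (X S)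

VarX : ∀ {n} → Dist n → Subset n → ℚ
VarX D S = expect D (λ R → X S R * X S R) - EX D S * EX D S

{-# OPTIONS --safe #-}
module Submission where

-- Write p = 2^{-i} and list S without repetition as L, so that X = Σ_{σ∈L} [σ ∈ R].
-- Linearity gives E X = |S| p and E X² = Σ_{σ,τ∈L} Pr[σ,τ ∈ R].  The diagonal σ = τ
-- contributes |S| p = E X.  Off the diagonal, uniformity turns Pr[σ,τ ∈ R] into p² times
-- the boost ratio of (σ, τ), so these terms add up to p² |S|(|S|-1) times the average
-- ratio over S.  As S is a candidate in the maximum defining Boost(D, |S|), this is at
-- most Boost(D, |S|) (|S| p)² = Boost(D, |S|) (E X)².

open import Defs
open import Algebra.Bundles using (CommutativeMonoid; CommutativeRing)
open import Data.Bool using (Bool; true; false; _∧_; if_then_else_)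
import Data.Bool.Properties as Bool
import Data.Integer as ℤ
import Data.Integer.Properties as ℤ
open import Data.List using (List; []; _∷_; map; length; foldr; filterᵇ)
open import Data.List.Properties using (map-cong; map-cong-local; foldr-preservesᵒ)
open import Data.List.Membership.Propositional using (_∈_)
open import Data.List.Membership.Propositional.Properties using (∈-map⁺; ∈-map⁻; ∈-++⁺ˡ; ∈-++⁺ʳ)
open import Data.List.Relation.Binary.Disjoint.Propositional using (Disjoint)
open import Data.List.Relation.Unary.All as All using (All; []; _∷_)
open import Data.List.Relation.Unary.AllPairs using ([]; _∷_)
open import Data.List.Relation.Unary.Any as Any using (here; there)
open import Data.List.Relation.Unary.Unique.Propositional using (Unique)
import Data.List.Relation.Unary.Unique.Propositional.Properties as Unique
open import Data.Nat as ℕ using (ℕ; zero; suc; _∸_; s≤s)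
import Data.Nat.Coprimality as Coprime
import Data.Nat.Properties as ℕ
open import Data.Product using (Σ-syntax; _,_; proj₁; proj₂)
open import Data.Rational using (ℚ; mkℚ; 0ℚ; 1ℚ; _+_; _*_; _-_; -_; _≤_; 1/_; Positive; nonNegative; ≢-nonZero)
  renaming (_≟_ to _≟ℚ_)
open import Data.Rational.Properties
open import Data.Rational.Solver using (module +-*-Solver)
open import Data.Sum using (_⊎_; [_,_]; inj₁; inj₂)
open import Data.Vec using (_∷_)
import Data.Vec.Properties as Vec
open import Function using (_∘_)
open import Relation.Binary using (DecidableEquality)
open import Relation.Binary.PropositionalEquality hiding ([_])
open import Relation.Nullary using (yes; no; does; contradiction)
open import Relation.Nullary.Decidable using (dec-true; dec-false; T?)

open import Algebra.Properties.CommutativeSemigroup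
  (CommutativeMonoid.commutativeSemigroup +-0-commutativeMonoid) using (interchange)
open import Algebra.Properties.Semiring.Mult
  (CommutativeRing.semiring +-*-commutativeRing) using (_×_; ×-homo-+; ×1-homo-*)

ℕtoℚ-suc : ∀ k → ℕtoℚ (suc k) ≡ 1ℚ + ℕtoℚ k
ℕtoℚ-suc k = begin
  ℕtoℚ (suc k)                      ≡⟨ /-cong (cong (ℤ._+_ ℤ.1ℤ) (sym (ℤ.*-identityʳ (ℤ.+ k)))) refl ⟩
  1ℚ + k/1                          ≡⟨ cong (1ℚ +_) (sym (↥p/↧p≡p k/1)) ⟩
  1ℚ + ℕtoℚ k                       ∎
  where
  open ≡-Reasoning
  -- 1ℚ + k/1 computes to (+ 1 ℤ.+ + k ℤ.* + 1) / 1.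
  k/1 : ℚ
  k/1 = mkℚ (ℤ.+ k) 0 (Coprime.sym (Coprime.1-coprimeTo k))

ℕtoℚ-× : ∀ k → ℕtoℚ k ≡ k × 1ℚ
ℕtoℚ-× zero    = refl
ℕtoℚ-× (suc k) = trans (ℕtoℚ-suc k) (cong (1ℚ +_) (ℕtoℚ-× k))

ℕtoℚ-+ : ∀ a b → ℕtoℚ (a ℕ.+ b) ≡ ℕtoℚ a + ℕtoℚ b
ℕtoℚ-+ a b = begin
  ℕtoℚ (a ℕ.+ b)       ≡⟨ ℕtoℚ-× (a ℕ.+ b) ⟩
  (a ℕ.+ b) × 1ℚ       ≡⟨ ×-homo-+ 1ℚ a b ⟩
  a × 1ℚ + b × 1ℚ      ≡⟨ sym (cong₂ _+_ (ℕtoℚ-× a) (ℕtoℚ-× b)) ⟩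
  ℕtoℚ a + ℕtoℚ b      ∎
  where open ≡-Reasoning

ℕtoℚ-* : ∀ a b → ℕtoℚ (a ℕ.* b) ≡ ℕtoℚ a * ℕtoℚ b
ℕtoℚ-* a b = begin
  ℕtoℚ (a ℕ.* b)       ≡⟨ ℕtoℚ-× (a ℕ.* b) ⟩
  (a ℕ.* b) × 1ℚ       ≡⟨ ×1-homo-* a b ⟩
  (a × 1ℚ) * (b × 1ℚ)  ≡⟨ sym (cong₂ _*_ (ℕtoℚ-× a) (ℕtoℚ-× b)) ⟩
  ℕtoℚ a * ℕtoℚ b      ∎
  where open ≡-Reasoning

ℕtoℚ-nonneg : ∀ k → 0ℚ ≤ ℕtoℚ k
ℕtoℚ-nonneg k = nonNegative⁻¹ (ℕtoℚ k) {{normalize-nonNeg k 1}}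

ℕtoℚ-suc-nonzero : ∀ k → ℕtoℚ (suc k) ≢ 0ℚ
ℕtoℚ-suc-nonzero k eq = <-irrefl (sym eq) (positive⁻¹ (ℕtoℚ (suc k)) {{normalize-pos (suc k) 1}})

ℕtoℚ-mono-≤ : ∀ {a b} → a ℕ.≤ b → ℕtoℚ a ≤ ℕtoℚ b
ℕtoℚ-mono-≤ {a} {b} a≤b = begin
  ℕtoℚ a                         ≡⟨ sym (+-identityʳ (ℕtoℚ a)) ⟩
  ℕtoℚ a + 0ℚ                    ≤⟨ +-monoʳ-≤ (ℕtoℚ a) (ℕtoℚ-nonneg (b ℕ.∸ a)) ⟩
  ℕtoℚ a + ℕtoℚ (b ℕ.∸ a)        ≡⟨ sym (ℕtoℚ-+ a (b ℕ.∸ a)) ⟩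
  ℕtoℚ (a ℕ.+ (b ℕ.∸ a))         ≡⟨ cong ℕtoℚ (ℕ.m+[n∸m]≡n a≤b) ⟩
  ℕtoℚ b                         ∎
  where open ≤-Reasoning

ℕtoℚ-m*[m∸1]≢0 : ∀ {m} → 2 ℕ.≤ m → ℕtoℚ (m ℕ.* (m ∸ 1)) ≢ 0ℚ
ℕtoℚ-m*[m∸1]≢0 {suc (suc k)} (s≤s (s≤s _)) = ℕtoℚ-suc-nonzero (k ℕ.+ suc k ℕ.* suc k)

ℕtoℚ-m*[m∸1]≤m*m : ∀ m → ℕtoℚ (m ℕ.* (m ∸ 1)) ≤ ℕtoℚ m * ℕtoℚ m
ℕtoℚ-m*[m∸1]≤m*m m =
  ≤-trans (ℕtoℚ-mono-≤ (ℕ.*-monoʳ-≤ m (ℕ.m∸n≤m m 1))) (≤-reflexive (ℕtoℚ-* m m))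

∑ : {A : Set} → List A → (A → ℚ) → ℚ
∑ xs f = sumℚ (map f xs)

syntax ∑ xs (λ x → e) = ∑[ x ∈ xs ] e

module _ {A : Set} where

  ∑-cong : ∀ {f g : A → ℚ} → f ≗ g → ∀ xs → ∑ xs f ≡ ∑ xs g
  ∑-cong f≗g xs = cong sumℚ (map-cong f≗g xs)

  ∑-cong-local : ∀ {f g : A → ℚ} {xs} → All (λ x → f x ≡ g x) xs → ∑ xs f ≡ ∑ xs g
  ∑-cong-local f≡g = cong sumℚ (map-cong-local f≡g)

  ∑-zero : ∀ {f : A → ℚ} {xs} → All (λ x → f x ≡ 0ℚ) xs → ∑ xs f ≡ 0ℚ
  ∑-zero []           = refl
  ∑-zero (fx≡0 ∷ f≡0) = trans (cong₂ _+_ fx≡0 (∑-zero f≡0)) (+-identityˡ 0ℚ)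

  ∑-const : ∀ (xs : List A) c → ∑[ _ ∈ xs ] c ≡ ℕtoℚ (length xs) * c
  ∑-const []       c = sym (*-zeroˡ c)
  ∑-const (_ ∷ xs) c = begin
    c + ∑[ _ ∈ xs ] c                ≡⟨ cong (c +_) (∑-const xs c) ⟩
    c + ℕtoℚ (length xs) * c         ≡⟨ cong (_+ ℕtoℚ (length xs) * c) (sym (*-identityˡ c)) ⟩
    1ℚ * c + ℕtoℚ (length xs) * c    ≡⟨ sym (*-distribʳ-+ c 1ℚ (ℕtoℚ (length xs))) ⟩
    (1ℚ + ℕtoℚ (length xs)) * c      ≡⟨ cong (_* c) (sym (ℕtoℚ-suc (length xs))) ⟩
    ℕtoℚ (suc (length xs)) * c       ∎
    where open ≡-Reasoning

  ∑-distrib-+ : ∀ (f g : A → ℚ) xs → ∑[ x ∈ xs ] (f x + g x) ≡ ∑ xs f + ∑ xs g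
  ∑-distrib-+ f g []       = sym (+-identityˡ 0ℚ)
  ∑-distrib-+ f g (x ∷ xs) =
    trans (cong (f x + g x +_) (∑-distrib-+ f g xs)) (interchange (f x) (g x) (∑ xs f) (∑ xs g))

  *-distribˡ-∑ : ∀ c (f : A → ℚ) xs → c * ∑ xs f ≡ ∑[ x ∈ xs ] (c * f x)
  *-distribˡ-∑ c f []       = *-zeroʳ c
  *-distribˡ-∑ c f (x ∷ xs) = trans (*-distribˡ-+ c (f x) (∑ xs f)) (cong (c * f x +_) (*-distribˡ-∑ c f xs))

  *-distribʳ-∑ : ∀ c (f : A → ℚ) xs → ∑ xs f * c ≡ ∑[ x ∈ xs ] (f x * c)
  *-distribʳ-∑ c f xs =
    trans (*-comm (∑ xs f) c) (trans (*-distribˡ-∑ c f xs) (∑-cong (λ x → *-comm c (f x)) xs))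

  ∑-nonneg : ∀ {f : A → ℚ} {xs} → All (λ x → 0ℚ ≤ f x) xs → 0ℚ ≤ ∑ xs f
  ∑-nonneg []           = ≤-refl
  ∑-nonneg (fx≥0 ∷ f≥0) = +-mono-≤ fx≥0 (∑-nonneg f≥0)

∑-comm : ∀ {A B : Set} (f : A → B → ℚ) xs ys → ∑[ x ∈ xs ] ∑[ y ∈ ys ] f x y ≡ ∑[ y ∈ ys ] ∑[ x ∈ xs ] f x y
∑-comm f []       ys = sym (∑-zero (All.universal (λ _ → refl) ys))
∑-comm f (x ∷ xs) ys =
  trans (cong (∑ ys (f x) +_) (∑-comm f xs ys)) (sym (∑-distrib-+ (f x) (λ y → ∑[ x ∈ xs ] f x y) ys))

∑-*-∑ : ∀ {A B : Set} (f : A → ℚ) (g : B → ℚ) xs ys → ∑ xs f * ∑ ys g ≡ ∑[ x ∈ xs ] ∑[ y ∈ ys ] (f x * g y)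
∑-*-∑ f g xs ys =
  trans (*-distribʳ-∑ (∑ ys g) f xs) (∑-cong (λ x → *-distribˡ-∑ (f x) g ys) xs)

𝟙 : Bool → ℚ
𝟙 b = if b then 1ℚ else 0ℚ

𝟙-∧ : ∀ a b → 𝟙 (a ∧ b) ≡ 𝟙 a * 𝟙 b
𝟙-∧ true  b = sym (*-identityˡ (𝟙 b))
𝟙-∧ false b = sym (*-zeroˡ (𝟙 b))

𝟙-nonneg : ∀ b → 0ℚ ≤ 𝟙 b
𝟙-nonneg true  = nonNegative⁻¹ 1ℚ
𝟙-nonneg false = ≤-refl

module _ {A : Set} (a : A → Bool) where

  countᵇ : List A → ℕ
  countᵇ = foldr (λ x k → if a x then suc k else k) 0

  ℕtoℚ-countᵇ : ∀ xs → ℕtoℚ (countᵇ xs) ≡ ∑[ x ∈ xs ] 𝟙 (a x)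
  ℕtoℚ-countᵇ []       = refl
  ℕtoℚ-countᵇ (x ∷ xs) with a x
  ... | true  = trans (ℕtoℚ-suc (countᵇ xs)) (cong (1ℚ +_) (ℕtoℚ-countᵇ xs))
  ... | false = trans (ℕtoℚ-countᵇ xs) (sym (+-identityˡ _))

  countᵇ≡length-filterᵇ : ∀ xs → countᵇ xs ≡ length (filterᵇ a xs)
  countᵇ≡length-filterᵇ []       = refl
  countᵇ≡length-filterᵇ (x ∷ xs) with a x
  ... | true  = cong suc (countᵇ≡length-filterᵇ xs)
  ... | false = countᵇ≡length-filterᵇ xs

  ∑-filterᵇ : ∀ (f : A → ℚ) xs → ∑ (filterᵇ a xs) f ≡ ∑[ x ∈ xs ] (𝟙 (a x) * f x)
  ∑-filterᵇ f []       = refl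
  ∑-filterᵇ f (x ∷ xs) with a x
  ... | true  = cong₂ _+_ (sym (*-identityˡ (f x))) (∑-filterᵇ f xs)
  ... | false = trans (∑-filterᵇ f xs) (sym (trans (cong (_+ _) (*-zeroˡ (f x))) (+-identityˡ _)))

  filterᵇ-∈-sublists : ∀ xs → filterᵇ a xs ∈ sublists xs
  filterᵇ-∈-sublists []       = here refl
  filterᵇ-∈-sublists (x ∷ xs) with a x
  ... | true  = ∈-++⁺ˡ (∈-map⁺ (x ∷_) (filterᵇ-∈-sublists xs))
  ... | false = ∈-++⁺ʳ (map (x ∷_) (sublists xs)) (filterᵇ-∈-sublists xs)

X≡∑𝟙 : ∀ {n} (S R : Subset n) → X S R ≡ ∑[ σ ∈ filterᵇ S (allPoints n) ] 𝟙 (R σ)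
X≡∑𝟙 {n} S R = begin
  ℕtoℚ (countᵇ (λ σ → S σ ∧ R σ) (allPoints n))     ≡⟨ ℕtoℚ-countᵇ _ (allPoints n) ⟩
  ∑[ σ ∈ allPoints n ] 𝟙 (S σ ∧ R σ)                ≡⟨ ∑-cong (λ σ → 𝟙-∧ (S σ) (R σ)) (allPoints n) ⟩
  ∑[ σ ∈ allPoints n ] (𝟙 (S σ) * 𝟙 (R σ))          ≡⟨ ∑-filterᵇ S _ (allPoints n) ⟨
  ∑[ σ ∈ filterᵇ S (allPoints n) ] 𝟙 (R σ)          ∎
  where open ≡-Reasoning

module _ {A : Set} (_≟_ : DecidableEquality A) where

  ∑-δ : ∀ {x xs} → Unique xs → x ∈ xs → ∑[ y ∈ xs ] 𝟙 (does (x ≟ y)) ≡ 1ℚ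
  ∑-δ {x} (x≢ys ∷ _) (here refl) =
    trans (cong₂ _+_ (cong 𝟙 (dec-true (x ≟ x) refl)) (∑-zero (All.map (cong 𝟙 ∘ dec-false (x ≟ _)) x≢ys)))
          (+-identityʳ 1ℚ)
  ∑-δ {x} {y ∷ _} (y≢ys ∷ ys-unique) (there x∈ys) =
    trans (cong₂ _+_ (cong 𝟙 (dec-false (x ≟ y) (≢-sym (All.lookup y≢ys x∈ys)))) (∑-δ ys-unique x∈ys))
          (+-identityˡ 1ℚ)

_≟ₚ_ : ∀ {n} → DecidableEquality (Point n)
_≟ₚ_ = Vec.≡-dec Bool._≟_

allPoints-unique : ∀ n → Unique (allPoints n)
allPoints-unique zero    = [] ∷ []
allPoints-unique (suc n) =
  Unique.++⁺ (Unique.map⁺ Vec.∷-injectiveʳ unique) (Unique.map⁺ Vec.∷-injectiveʳ unique) heads-differ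
  where
  unique : Unique (allPoints n)
  unique = allPoints-unique n
  heads-differ : Disjoint (map (true ∷_) (allPoints n)) (map (false ∷_) (allPoints n))
  heads-differ (σ∈ , τ∈) with ∈-map⁻ (true ∷_) σ∈ | ∈-map⁻ (false ∷_) τ∈
  ... | _ , _ , refl | _ , _ , ()

∈-filterLen : ∀ {A : Set} {M} {xs : List A} {xss} → xs ∈ xss → M ℕ.≤ length xs → xs ∈ filterLen M xss
∈-filterLen {M = M} {xss = ys ∷ _} xs∈ M≤ with M ℕ.≤? length ys
∈-filterLen (here refl)  M≤ | yes _  = here refl
∈-filterLen (there xs∈) M≤ | yes _  = there (∈-filterLen xs∈ M≤)
∈-filterLen (here refl)  M≤ | no M≰ = contradiction M≤ M≰
∈-filterLen (there xs∈) M≤ | no _   = ∈-filterLen xs∈ M≤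

≤-maxℚ : ∀ {x xs} → x ∈ xs → x ≤ maxℚ xs
≤-maxℚ {x} {y ∷ ys} x∈ = foldr-preservesᵒ (λ a b → [ p≤q⇒p≤q⊔r b , p≤q⇒p≤r⊔q a ]) y ys (head-or-tail x∈)
  where
  head-or-tail : x ∈ y ∷ ys → x ≤ y ⊎ Any.Any (x ≤_) ys
  head-or-tail (here refl)   = inj₁ ≤-refl
  head-or-tail (there x∈ys) = inj₂ (Any.map ≤-reflexive x∈ys)

avgPair≤Boost : ∀ {n} (D : Dist n) {M S'} → S' ∈ sublists (allPoints n) → M ℕ.≤ length S' → avgPair D S' ≤ Boost D M
avgPair≤Boost D S'∈ M≤ = ≤-maxℚ (∈-map⁺ (avgPair D) (∈-filterLen S'∈ M≤))

ratio-*-cancel : ∀ x {y} → y ≢ 0ℚ → ratio x y * y ≡ x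
ratio-*-cancel x {y} y≢0 with y ≟ℚ 0ℚ
... | yes y≡0 = contradiction y≡0 y≢0
... | no  _   = begin
  x * 1/ y * y    ≡⟨ *-assoc x (1/ y) y ⟩
  x * (1/ y * y)  ≡⟨ cong (x *_) (*-inverseˡ y) ⟩
  x * 1ℚ          ≡⟨ *-identityʳ x ⟩
  x               ∎
  where
  open ≡-Reasoning
  instance _ = ≢-nonZero y≢0

ratio-nonneg : ∀ {x y} → 0ℚ ≤ x → 0ℚ ≤ y → 0ℚ ≤ ratio x y
ratio-nonneg {x} {y} 0≤x 0≤y with y ≟ℚ 0ℚ
... | yes _   = ≤-refl
... | no  y≢0 = nonNegative⁻¹ (x * y⁻¹) {{nonNeg*nonNeg⇒nonNeg x y⁻¹ {{pos⇒nonNeg y⁻¹ {{1/pos⇒pos y}}}}}}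
  where
  instance
    _ = nonNegative 0≤x
    y>0 : Positive y
    y>0 = nonNeg∧nonZero⇒pos y {{nonNegative 0≤y}} {{≢-nonZero y≢0}}
  y⁻¹ : ℚ
  y⁻¹ = (1/ y) {{pos⇒nonZero y}}

*-nonneg : ∀ {x y} → 0ℚ ≤ x → 0ℚ ≤ y → 0ℚ ≤ x * y
*-nonneg {x} {y} 0≤x 0≤y = nonNegative⁻¹ (x * y) {{nonNeg*nonNeg⇒nonNeg x {{nonNegative 0≤x}} y {{nonNegative 0≤y}}}}

pow2inv-pos : ∀ i → Positive (pow2inv i)
pow2inv-pos zero    = _
pow2inv-pos (suc i) = pos*pos⇒pos _ (pow2inv i) {{pow2inv-pos i}}

pow2inv²-pos : ∀ i → Positive (pow2inv i * pow2inv i)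
pow2inv²-pos i = pos*pos⇒pos (pow2inv i) (pow2inv i)
  where instance _ = pow2inv-pos i

NonNegativeWeights : ∀ {n} → Dist n → Set
NonNegativeWeights D = All (λ q → 0ℚ ≤ proj₂ q) D

module _ {n} (D : Dist n) where

  expect-cong : ∀ {f g : Subset n → ℚ} → f ≗ g → expect D f ≡ expect D g
  expect-cong f≗g = ∑-cong (λ q → cong (proj₂ q *_) (f≗g (proj₁ q))) D

  expect-∑ : ∀ {B : Set} (f : B → Subset n → ℚ) xs →
             expect D (λ R → ∑[ x ∈ xs ] f x R) ≡ ∑[ x ∈ xs ] expect D (f x)
  expect-∑ f xs =
    trans (∑-cong (λ q → *-distribˡ-∑ (proj₂ q) (λ x → f x (proj₁ q)) xs) D) (∑-comm _ D xs)

  expect-nonneg : NonNegativeWeights D → ∀ {f} → (∀ R → 0ℚ ≤ f R) → 0ℚ ≤ expect D f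
  expect-nonneg weights≥0 f≥0 = ∑-nonneg (All.map (λ w≥0 → *-nonneg w≥0 (f≥0 _)) weights≥0)

  prob-nonneg : NonNegativeWeights D → ∀ E → 0ℚ ≤ prob D E
  prob-nonneg weights≥0 E = expect-nonneg weights≥0 (λ R → 𝟙-nonneg (E R))

  expect-∑𝟙-square : ∀ xs →
    expect D (λ R → ∑[ σ ∈ xs ] 𝟙 (R σ) * ∑[ σ ∈ xs ] 𝟙 (R σ)) ≡ ∑[ σ ∈ xs ] ∑[ τ ∈ xs ] Pr2 D σ τ
  expect-∑𝟙-square xs = begin
    expect D (λ R → ∑[ σ ∈ xs ] 𝟙 (R σ) * ∑[ σ ∈ xs ] 𝟙 (R σ))
      ≡⟨ expect-cong (λ R → ∑-*-∑ (λ σ → 𝟙 (R σ)) (λ τ → 𝟙 (R τ)) xs xs) ⟩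
    expect D (λ R → ∑[ σ ∈ xs ] ∑[ τ ∈ xs ] (𝟙 (R σ) * 𝟙 (R τ)))
      ≡⟨ expect-∑ _ xs ⟩
    ∑[ σ ∈ xs ] expect D (λ R → ∑[ τ ∈ xs ] (𝟙 (R σ) * 𝟙 (R τ)))
      ≡⟨ ∑-cong (λ σ → expect-∑ _ xs) xs ⟩
    ∑[ σ ∈ xs ] ∑[ τ ∈ xs ] expect D (λ R → 𝟙 (R σ) * 𝟙 (R τ))
      ≡⟨ ∑-cong (λ σ → ∑-cong (λ τ → expect-cong (λ R → sym (𝟙-∧ (R σ) (R τ)))) xs) xs ⟩
    ∑[ σ ∈ xs ] ∑[ τ ∈ xs ] Pr2 D σ τ
      ∎
    where open ≡-Reasoning

-- Defs defines the summand of pairSum in an anonymous where-block.  Unifying with the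
-- body of pairSum recovers it, so pairSum D S' is definitionally ∑∑ pairTerm D S', and
-- `with σ ≟ₚ τ` evaluates pairTerm D S' σ τ.
pairSum-summand : Σ[ term ∈ (∀ {n} → Dist n → List (Point n) → Point n → Point n → ℚ) ]
                    (∀ {n} (D : Dist n) S' → pairSum D S' ≡ ∑[ σ ∈ S' ] ∑[ τ ∈ S' ] term D S' σ τ)
pairSum-summand = _ , λ _ _ → refl

pairTerm : ∀ {n} → Dist n → List (Point n) → Point n → Point n → ℚ
pairTerm = proj₁ pairSum-summand

pairTerm-nonneg : ∀ {n} {D : Dist n} → NonNegativeWeights D → ∀ S' σ τ → 0ℚ ≤ pairTerm D S' σ τ
pairTerm-nonneg {D = D} weights≥0 S' σ τ with σ ≟ₚ τ
... | yes _ = ≤-refl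
... | no  _ = ratio-nonneg (Pr≥0 (λ R → R σ ∧ R τ)) (*-nonneg (Pr≥0 (λ R → R σ)) (Pr≥0 (λ R → R τ)))
  where
  Pr≥0 : ∀ E → 0ℚ ≤ prob D E
  Pr≥0 = prob-nonneg D weights≥0

avgPair≤⇒pairSum≤ : ∀ {n} {D : Dist n} → NonNegativeWeights D → ∀ S' {b} → 2 ℕ.≤ length S' →
                    avgPair D S' ≤ b → pairSum D S' ≤ b * (ℕtoℚ (length S') * ℕtoℚ (length S'))
avgPair≤⇒pairSum≤ {D = D} weights≥0 S' {b} 2≤m avg≤b = begin
  pairSum D S'          ≡⟨ sym (ratio-*-cancel (pairSum D S') (ℕtoℚ-m*[m∸1]≢0 2≤m)) ⟩
  avgPair D S' * pairs  ≤⟨ *-monoˡ-≤-nonNeg (avgPair D S') {{nonNegative avg≥0}} (ℕtoℚ-m*[m∸1]≤m*m m) ⟩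
  avgPair D S' * m²     ≤⟨ *-monoʳ-≤-nonNeg m² {{nonNegative m²≥0}} avg≤b ⟩
  b * m²                ∎
  where
  open ≤-Reasoning
  m : ℕ
  m = length S'
  pairs m² : ℚ
  pairs = ℕtoℚ (m ℕ.* (m ∸ 1))
  m²    = ℕtoℚ m * ℕtoℚ m
  m²≥0 : 0ℚ ≤ m²
  m²≥0 = *-nonneg (ℕtoℚ-nonneg m) (ℕtoℚ-nonneg m)
  avg≥0 : 0ℚ ≤ avgPair D S'
  avg≥0 = ratio-nonneg
    (∑-nonneg (All.universal (λ σ → ∑-nonneg (All.universal (pairTerm-nonneg weights≥0 S' σ) S')) S'))
    (ℕtoℚ-nonneg (m ℕ.* (m ∸ 1)))

module _ {n} (D : Dist n) (i : ℕ) (uniform : IsUniform i D) where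

  private
    p : ℚ
    p = pow2inv i

  p*p≢0 : p * p ≢ 0ℚ
  p*p≢0 p*p≡0 = <-irrefl (sym p*p≡0) (positive⁻¹ (p * p) {{pow2inv²-pos i}})

  Pr2-decomposition : ∀ S' σ τ → Pr2 D σ τ ≡ 𝟙 (does (σ ≟ₚ τ)) * p + pairTerm D S' σ τ * (p * p)
  Pr2-decomposition S' σ τ with σ ≟ₚ τ
  ... | yes refl = begin
    Pr2 D σ σ                ≡⟨ expect-cong D (λ R → cong 𝟙 (Bool.∧-idem (R σ))) ⟩
    Pr1 D σ                  ≡⟨ uniform σ ⟩
    p                        ≡⟨ sym (trans (cong₂ _+_ (*-identityˡ p) (*-zeroˡ (p * p))) (+-identityʳ p)) ⟩
    1ℚ * p + 0ℚ * (p * p)    ∎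
    where open ≡-Reasoning
  ... | no _ = sym (begin
    0ℚ * p + ratio (Pr2 D σ τ) (Pr1 D σ * Pr1 D τ) * (p * p)
      ≡⟨ cong₂ _+_ (*-zeroˡ p) (cong (λ q → ratio (Pr2 D σ τ) q * (p * p)) (cong₂ _*_ (uniform σ) (uniform τ))) ⟩
    0ℚ + ratio (Pr2 D σ τ) (p * p) * (p * p)
      ≡⟨ +-identityˡ _ ⟩
    ratio (Pr2 D σ τ) (p * p) * (p * p)
      ≡⟨ ratio-*-cancel (Pr2 D σ τ) p*p≢0 ⟩
    Pr2 D σ τ
      ∎)
    where open ≡-Reasoning

  ∑∑-Pr2 : ∀ {xs} → Unique xs →
          ∑[ σ ∈ xs ] ∑[ τ ∈ xs ] Pr2 D σ τ ≡ ℕtoℚ (length xs) * p + pairSum D xs * (p * p)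
  ∑∑-Pr2 {xs} unique = begin
    ∑[ σ ∈ xs ] ∑[ τ ∈ xs ] Pr2 D σ τ
      ≡⟨ ∑-cong (λ σ → ∑-cong (Pr2-decomposition xs σ) xs) xs ⟩
    ∑[ σ ∈ xs ] ∑[ τ ∈ xs ] (δ σ τ * p + pairTerm D xs σ τ * (p * p))
      ≡⟨ ∑-cong (λ σ → ∑-distrib-+ _ _ xs) xs ⟩
    ∑[ σ ∈ xs ] (∑[ τ ∈ xs ] (δ σ τ * p) + ∑[ τ ∈ xs ] (pairTerm D xs σ τ * (p * p)))
      ≡⟨ ∑-distrib-+ _ _ xs ⟩
    ∑[ σ ∈ xs ] ∑[ τ ∈ xs ] (δ σ τ * p) + ∑[ σ ∈ xs ] ∑[ τ ∈ xs ] (pairTerm D xs σ τ * (p * p))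
      ≡⟨ cong₂ _+_ diagonal off-diagonal ⟩
    ℕtoℚ (length xs) * p + pairSum D xs * (p * p)
      ∎
    where
    open ≡-Reasoning
    δ : Point n → Point n → ℚ
    δ σ τ = 𝟙 (does (σ ≟ₚ τ))
    diagonal : ∑[ σ ∈ xs ] ∑[ τ ∈ xs ] (δ σ τ * p) ≡ ℕtoℚ (length xs) * p
    diagonal = trans (∑-cong-local (All.tabulate row)) (∑-const xs p)
      where
      row : ∀ {σ} → σ ∈ xs → ∑[ τ ∈ xs ] (δ σ τ * p) ≡ p
      row {σ} σ∈xs = trans (sym (*-distribʳ-∑ p (δ σ) xs))
                       (trans (cong (_* p) (∑-δ _≟ₚ_ unique σ∈xs)) (*-identityˡ p))
    off-diagonal : ∑[ σ ∈ xs ] ∑[ τ ∈ xs ] (pairTerm D xs σ τ * (p * p)) ≡ pairSum D xs * (p * p)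
    off-diagonal = sym (trans (*-distribʳ-∑ (p * p) _ xs) (∑-cong (λ σ → *-distribʳ-∑ (p * p) _ xs) xs))

  EX≡ : ∀ S → EX D S ≡ ℕtoℚ (length (filterᵇ S (allPoints n))) * p
  EX≡ S = begin
    EX D S                                      ≡⟨ expect-cong D (X≡∑𝟙 S) ⟩
    expect D (λ R → ∑[ σ ∈ L ] 𝟙 (R σ))         ≡⟨ expect-∑ D (λ σ R → 𝟙 (R σ)) L ⟩
    ∑[ σ ∈ L ] Pr1 D σ                          ≡⟨ ∑-cong uniform L ⟩
    ∑[ σ ∈ L ] p                                ≡⟨ ∑-const L p ⟩
    ℕtoℚ (length L) * p                         ∎
    where
    open ≡-Reasoning
    L : List (Point n)
    L = filterᵇ S (allPoints n)

  EX²≡ : ∀ S → let L = filterᵇ S (allPoints n) in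
         expect D (λ R → X S R * X S R) ≡ ℕtoℚ (length L) * p + pairSum D L * (p * p)
  EX²≡ S = begin
    expect D (λ R → X S R * X S R)                        ≡⟨ expect-cong D (λ R → cong₂ _*_ (X≡∑𝟙 S R) (X≡∑𝟙 S R)) ⟩
    expect D (λ R → ∑[ σ ∈ L ] 𝟙 (R σ) * ∑[ σ ∈ L ] 𝟙 (R σ)) ≡⟨ expect-∑𝟙-square D L ⟩
    ∑[ σ ∈ L ] ∑[ τ ∈ L ] Pr2 D σ τ                       ≡⟨ ∑∑-Pr2 (Unique.filter⁺ (T? ∘ S) (allPoints-unique n)) ⟩
    ℕtoℚ (length L) * p + pairSum D L * (p * p)           ∎
    where
    open ≡-Reasoning
    L : List (Point n)
    L = filterᵇ S (allPoints n)

lemma3 : (n i : ℕ) (D : Dist n) → IsDist D → IsUniform i D →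
    (S : Subset n) → 2 ℕ.≤ count S →
    VarX D S ≤ EX D S + (Boost D (count S) - 1ℚ) * (EX D S * EX D S)
lemma3 n i D (weights≥0 , _) uniform S 2≤|S| = begin
  VarX D S                               ≡⟨ cong₂ _-_ (EX²≡ D i uniform S) (cong₂ _*_ EX≡e EX≡e) ⟩
  (e + P * (p * p)) - e * e              ≤⟨ +-monoˡ-≤ (- (e * e)) (+-monoʳ-≤ e P*p²≤) ⟩
  (e + B * (e * e)) - e * e              ≡⟨ regroup e B ⟩
  e + (B - 1ℚ) * (e * e)                 ≡⟨ cong (λ x → x + (B - 1ℚ) * (x * x)) (sym EX≡e) ⟩
  EX D S + (B - 1ℚ) * (EX D S * EX D S)  ∎
  where
  open ≤-Reasoning
  open +-*-Solver
  L : List (Point n)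
  L = filterᵇ S (allPoints n)
  p m e P B : ℚ
  p = pow2inv i
  m = ℕtoℚ (length L)
  e = m * p
  P = pairSum D L
  B = Boost D (count S)

  EX≡e : EX D S ≡ e
  EX≡e = EX≡ D i uniform S

  |S|≡|L| : count S ≡ length L
  |S|≡|L| = countᵇ≡length-filterᵇ S (allPoints n)

  P≤ : P ≤ B * (m * m)
  P≤ = avgPair≤⇒pairSum≤ weights≥0 L (subst (2 ℕ.≤_) |S|≡|L| 2≤|S|)
         (avgPair≤Boost D (filterᵇ-∈-sublists S (allPoints n)) (ℕ.≤-reflexive |S|≡|L|))

  rearrange : ∀ b m p → b * (m * m) * (p * p) ≡ b * ((m * p) * (m * p))
  rearrange = solve 3 (λ b m p → b :* (m :* m) :* (p :* p) := b :* ((m :* p) :* (m :* p))) refl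

  P*p²≤ : P * (p * p) ≤ B * (e * e)
  P*p²≤ = ≤-trans (*-monoʳ-≤-nonNeg (p * p) {{pos⇒nonNeg (p * p) {{pow2inv²-pos i}}}} P≤)
                  (≤-reflexive (rearrange B m p))

  regroup : ∀ e b → (e + b * (e * e)) - e * e ≡ e + (b - 1ℚ) * (e * e)
  regroup = solve 2 (λ e b → (e :+ b :* (e :* e)) :- e :* e := e :+ (b :- con 1ℚ) :* (e :* e)) refl
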